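{- Let $G=(V,E)$ be a connected graph with a fixed spanning tree $T$, let $u\in V$, and let $\alpha$ and $c$ be two proper 3-colourings of $G$. If $\alpha$ and $c$ belong to the same connected component of $R_3(G)$, then for each edge $vw\in E$, $$h_{\alpha,u}(c,v)-h_{\alpha,u}(c,w)+w(c,\overrightarrow{vw})=w(\alpha,\overrightarrow{vw}).$$
   Context: A proper 3-colouring is a map $c:V\to\{1,2,3\}$ with $c(x)\ne c(y)$ for all $xy\in E$. $R_3(G)$ is the graph whose vertices are the proper 3-colourings of $G$, two adjacent iff they differ on exactly one vertex. For an edge oriented from $x$ to $y$, $w(c,\overrightarrow{xy})\in\{ -1,1\}$ is the value with $w(c,\overrightarrow{xy})\equiv c(y)-c(x)\pmod 3$. The weight of an oriented path is the sum of the weights of its edges. $\overrightarrow{P_{uv}}$ is the path from $u$ to $v$ in $T$, oriented from $u$ to $v$, and $h_{\alpha,u}(c,v)=w(c,\overrightarrow{P_{uv}})-w(\alpha,\overrightarrow{P_{uv}})$. -}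

module Defs where

open import Data.Nat using (ℕ; suc; _≤_)
open import Data.Fin using (Fin; zero; suc; _≟_)
open import Data.Integer using (ℤ; 0ℤ; 1ℤ; -1ℤ; _+_; _-_)
open import Data.List using (List; []; _∷_; length)
open import Data.List.Relation.Unary.Unique.Propositional using (Unique)
open import Data.Product using (Σ; _×_; ∃; ∃-syntax)
open import Data.Bool using (if_then_else_)
open import Relation.Nullary using (¬_; does)
open import Relation.Binary.PropositionalEquality using (_≡_; _≢_)
open import Relation.Binary.Construct.Closure.ReflexiveTransitive using (Star)

record Graph (n : ℕ) : Set₁ where
  field
    Adj     : Fin n → Fin n → Set
    sym     : ∀ {x y} → Adj x y → Adj y x
    irrefl  : ∀ {x} → ¬ Adj x x
open Graph public

data Walk {n : ℕ} (A : Fin n → Fin n → Set) : Fin n → Fin n → Set where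
  []  : ∀ {x} → Walk A x x
  _∷_ : ∀ {x y z} → A x y → Walk A y z → Walk A x z

verts : ∀ {n} {A : Fin n → Fin n → Set} {x y : Fin n} → Walk A x y → List (Fin n)
verts {x = x} []      = x ∷ []
verts {x = x} (e ∷ p) = x ∷ verts p

edgeCount : ∀ {n} {A : Fin n → Fin n → Set} {x y : Fin n} → Walk A x y → ℕ
edgeCount []      = 0
edgeCount (e ∷ p) = suc (edgeCount p)

IsPath : ∀ {n} {A : Fin n → Fin n → Set} {x y : Fin n} → Walk A x y → Set
IsPath p = Unique (verts p)

Connected : ∀ {n} → Graph n → Set
Connected G = ∀ x y → Walk (Adj G) x y

-- A cycle (length ≥ 3) in the relation A: an edge x–y plus a path from y
-- back to x with at least two edges.
HasCycle : ∀ {n} → (Fin n → Fin n → Set) → Set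
HasCycle A = ∃[ x ] ∃[ y ] (A x y × Σ (Walk A y x) λ p → IsPath p × (2 ≤ edgeCount p))

record SpanningTree {n : ℕ} (G : Graph n) : Set₁ where
  field
    TAdj    : Fin n → Fin n → Set
    sub     : ∀ {x y} → TAdj x y → Adj G x y
    tsym    : ∀ {x y} → TAdj x y → TAdj y x
    tconn   : ∀ x y → Walk TAdj x y
    acyclic : ¬ HasCycle TAdj
open SpanningTree public

Colouring : ℕ → Set
Colouring n = Fin n → Fin 3

Proper : ∀ {n} → Graph n → Colouring n → Set
Proper G c = ∀ {x y} → Adj G x y → c x ≢ c y

R3Adj : ∀ {n} → Graph n → Colouring n → Colouring n → Set
R3Adj G c c' = Proper G c × Proper G c' ×
  (∃[ v ] (c v ≢ c' v × (∀ x → x ≢ v → c x ≡ c' x)))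

SameComponent : ∀ {n} → Graph n → Colouring n → Colouring n → Set
SameComponent G = Star (R3Adj G)

succ3 : Fin 3 → Fin 3
succ3 zero             = suc zero
succ3 (suc zero)       = suc (suc zero)
succ3 (suc (suc zero)) = zero

-- w for colours a = c(x), b = c(y) of an edge oriented x → y:
-- +1 if b - a ≡ 1 (mod 3), else -1 (used only when a ≢ b).
wt : Fin 3 → Fin 3 → ℤ
wt a b = if does (b ≟ succ3 a) then 1ℤ else -1ℤ

weight : ∀ {n} {A : Fin n → Fin n → Set} → Colouring n → {x y : Fin n} → Walk A x y → ℤ
weight c []                 = 0ℤ
weight c (_∷_ {x} {y} e p)  = wt (c x) (c y) + weight c p

-- h_{α,u}(c,v), given the (unique) tree path p from u to v.
h : ∀ {n} {A : Fin n → Fin n → Set} → Colouring n → Colouring n → {u v : Fin n} → Walk A u v → ℤ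
h α c p = weight c p - weight α p

-- Recolouring one vertex changes the weight of each edge yz by F z − F y, where
-- F depends only on the old and new colour of a vertex (and vanishes where the
-- colour is unchanged); this is a finite check that uses properness of both
-- colourings. Hence the weight of a walk changes by a potential difference, and
-- the weight of the closed walk pv · vw · pw⁻¹ is invariant along paths in
-- R₃(G). Unfolding h, the claimed identity says exactly that this closed walk
-- has the same weight under c as under α.
module Submission where

open import Defs hiding (sym)
open import Data.Fin using (Fin; _≟_)
open import Data.Fin.Properties using (all?)
open import Data.Integer using (ℤ; 0ℤ; _+_; _-_)
import Data.Integer.Properties as ℤ
open import Data.Integer.Tactic.RingSolver using (solve-∀)
open import Data.Product using (_,_)
open import Data.Sum using (_⊎_; inj₁; inj₂)
open import Relation.Nullary using (yes; no)
open import Relation.Nullary.Decidable using (from-yes; ¬?; _→-dec_; _⊎-dec_)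
open import Relation.Binary.PropositionalEquality
  using (_≡_; _≢_; refl; sym; trans; cong; cong₂; subst; module ≡-Reasoning)
open import Relation.Binary.Construct.Closure.ReflexiveTransitive using (Star; ε; _◅_)

Δ : Fin 3 → Fin 3 → ℤ
Δ a a' = wt a' a - wt a a'

wt-recolour : ∀ a b a' b' → a ≢ b → a' ≢ b' → a ≡ a' ⊎ b ≡ b'
            → wt a' b' - wt a b ≡ Δ b b' - Δ a a'
wt-recolour = from-yes (all? λ a → all? λ b → all? λ a' → all? λ b' →
  ¬? (a ≟ b) →-dec ¬? (a' ≟ b') →-dec (a ≟ a' ⊎-dec b ≟ b')
  →-dec wt a' b' - wt a b ℤ.≟ Δ b b' - Δ a a')

module SingleRecolouring {n} (G : Graph n) {c c' : Colouring n} (x : Fin n)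
  (c-proper : Proper G c) (c'-proper : Proper G c') (agree : ∀ y → y ≢ x → c y ≡ c' y) where

  potential : Fin n → ℤ
  potential y = Δ (c y) (c' y)

  wt-shift : ∀ {y z} → Adj G y z
           → wt (c' y) (c' z) - wt (c y) (c z) ≡ potential z - potential y
  wt-shift {y} {z} e =
    wt-recolour (c y) (c z) (c' y) (c' z) (c-proper e) (c'-proper e) endpoint-kept
    where
    endpoint-kept : c y ≡ c' y ⊎ c z ≡ c' z
    endpoint-kept with y ≟ x
    ... | no y≢x   = inj₁ (agree y y≢x)
    ... | yes refl = inj₂ (agree z λ z≡y → irrefl G (subst (Adj G y) z≡y e))

  weight-shift : ∀ {A : Fin n → Fin n → Set} → (∀ {y z} → A y z → Adj G y z)
               → ∀ {s t} (p : Walk A s t)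
               → weight c' p - weight c p ≡ potential t - potential s
  weight-shift sub {s} [] = sym (ℤ.+-inverseʳ (potential s))
  weight-shift sub {s} {t} (_∷_ {y = y} e p) = begin
    (wt (c' s) (c' y) + weight c' p) - (wt (c s) (c y) + weight c p)
      ≡⟨ interchange (wt (c' s) (c' y)) (weight c' p) (wt (c s) (c y)) (weight c p) ⟩
    (wt (c' s) (c' y) - wt (c s) (c y)) + (weight c' p - weight c p)
      ≡⟨ cong₂ _+_ (wt-shift (sub e)) (weight-shift sub p) ⟩
    (potential y - potential s) + (potential t - potential y)
      ≡⟨ telescope (potential s) (potential y) (potential t) ⟩
    potential t - potential s ∎
    where
    open ≡-Reasoning
    interchange : ∀ a b a' b' → (a + b) - (a' + b') ≡ (a - a') + (b - b')
    interchange = solve-∀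
    telescope : ∀ i j k → (j - i) + (k - j) ≡ k - i
    telescope = solve-∀

circulation : ∀ {n} {A B : Fin n → Fin n → Set} {u v w : Fin n}
            → Colouring n → Walk A u v → Walk B u w → ℤ
circulation {v = v} {w} d p q = weight d p + wt (d v) (d w) - weight d q

module _ {n} (G : Graph n) {A B : Fin n → Fin n → Set}
  (A⊆G : ∀ {y z} → A y z → Adj G y z) (B⊆G : ∀ {y z} → B y z → Adj G y z)
  {u v w : Fin n} (e : Adj G v w) (p : Walk A u v) (q : Walk B u w) where

  circulation-step : ∀ {d d'} → R3Adj G d d' → circulation d' p q ≡ circulation d p q
  circulation-step {d} {d'} (d-proper , d'-proper , x , _ , agree) = begin
    circulation d' p q
      ≡⟨ split (weight d' p) (wt (d' v) (d' w)) (weight d' q) (weight d p) (wt (d v) (d w)) (weight d q) ⟩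
    circulation d p q + ((weight d' p - weight d p) + (wt (d' v) (d' w) - wt (d v) (d w))
                         - (weight d' q - weight d q))
      ≡⟨ cong (λ k → circulation d p q + k) (cong₂ _-_
           (cong₂ _+_ (weight-shift A⊆G p) (wt-shift e)) (weight-shift B⊆G q)) ⟩
    circulation d p q + ((F v - F u) + (F w - F v) - (F w - F u))
      ≡⟨ cancel (circulation d p q) (F u) (F v) (F w) ⟩
    circulation d p q ∎
    where
    open ≡-Reasoning
    open SingleRecolouring G x d-proper d'-proper agree renaming (potential to F)
    split : ∀ P' E' Q' P E Q → P' + E' - Q' ≡ (P + E - Q) + ((P' - P) + (E' - E) - (Q' - Q))
    split = solve-∀
    cancel : ∀ k i j l → k + ((j - i) + (l - j) - (l - i)) ≡ k
    cancel = solve-∀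

  circulation-invariant : ∀ {d d'} → SameComponent G d d' → circulation d' p q ≡ circulation d p q
  circulation-invariant ε            = refl
  circulation-invariant (step ◅ rest) = trans (circulation-invariant rest) (circulation-step step)

-- The identity holds for arbitrary walks pv and pw in G.
lemma5 : ∀ {n} (G : Graph n) → Connected G → (T : SpanningTree G) → (u : Fin n)
         → (α c : Colouring n) → Proper G α → Proper G c → SameComponent G α c
         → ∀ v w → Adj G v w
         → (pv : Walk (TAdj T) u v) → IsPath pv
         → (pw : Walk (TAdj T) u w) → IsPath pw
         → h α c pv - h α c pw + wt (c v) (c w) ≡ wt (α v) (α w)
lemma5 G _ T u α c _ _ α~c v w e pv _ pw _ = begin
  h α c pv - h α c pw + wt (c v) (c w)
    ≡⟨ regroup (weight c pv) (weight α pv) (weight c pw) (weight α pw) (wt (c v) (c w)) (wt (α v) (α w)) ⟩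
  wt (α v) (α w) + (circulation c pv pw - circulation α pv pw)
    ≡⟨ cong (λ k → wt (α v) (α w) + (k - circulation α pv pw))
         (circulation-invariant G (sub T) (sub T) e pv pw α~c) ⟩
  wt (α v) (α w) + (circulation α pv pw - circulation α pv pw)
    ≡⟨ cong (wt (α v) (α w) +_) (ℤ.+-inverseʳ (circulation α pv pw)) ⟩
  wt (α v) (α w) + 0ℤ
    ≡⟨ ℤ.+-identityʳ (wt (α v) (α w)) ⟩
  wt (α v) (α w) ∎
  where
  open ≡-Reasoning
  regroup : ∀ P P' Q Q' E E' → (P - P') - (Q - Q') + E ≡ E' + ((P + E - Q) - (P' + E' - Q'))
  regroup = solve-∀
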